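{- Let $\Gamma$ be a finite thick linear space with point set $\mathcal P$ and line set $\mathcal L$ such that the triangle complex $\Delta(\Gamma)$ is a flag-transitive geometry, let $\phi\in\mathrm{Aut}(\Delta(\Gamma))$ and $i\in\{1,2,3\}$. Then: (1) for every $p\in\mathcal P$ and all lines $L,L'$ incident with $p$, $\pi_1(\phi((p,L,i)))=\pi_1(\phi((p,L',i)))$; (2) for every $L\in\mathcal L$ and all points $p,p'$ incident with $L$, $\pi_2(\phi((p,L,i)))=\pi_2(\phi((p',L,i)))$.
   Context: A linear space is a rank two geometry of points and lines in which every line has at least two points, every point is on at least two lines, and any two distinct points lie on exactly one common line; it is thick if every line has at least three points and every point is on at least three lines. Triangle complex: $\Delta(\Gamma)$ is the rank three incidence system over $\{1,2,3\}$ whose elements are the triples $(p,L,i)$ with $p$ incident with $L$ and $i\in\{1,2,3\}$; the type of $(p,L,i)$ is $i$; and $(p,L,i)$ is incident with $(p',L',i \bmod 3+1)$ if and only if the set of points incident with both $L$ and $L'$ is exactly $\{p\}$ and $p\neq p'$ (incidence symmetric and reflexive, no other incidences). Automorphisms are type-preserving incidence-preserving bijections; flag-transitive means the automorphism group is transitive on chambers. The projections are $\pi_1((p,L,i))=p$ and $\pi_2((p,L,i))=L$. -}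

module Defs where

open import Data.Nat using (ℕ)
open import Data.Fin using (Fin; zero; suc)
open import Data.Bool using (Bool; true)
open import Data.Maybe using (Maybe; just)
open import Data.Product using (Σ; ∃; ∃-syntax; _×_)
open import Data.Sum using (_⊎_)
open import Relation.Nullary using (¬_)
open import Relation.Binary.PropositionalEquality using (_≡_)

-- Types {1,2,3} are represented by Fin 3 = {0,1,2}; "i mod 3 + 1" becomes next.
next : Fin 3 → Fin 3
next zero = suc zero
next (suc zero) = suc (suc zero)
next (suc (suc zero)) = zero

module _ {n m : ℕ} (I : Fin n → Fin m → Bool) where

  _on_ : Fin n → Fin m → Set
  p on L = I p L ≡ true

  record IsThickLinearSpace : Set where
    field
      line-three-points : ∀ (L : Fin m) → ∃[ p ] ∃[ q ] ∃[ r ]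
        (p on L × q on L × r on L × ¬ p ≡ q × ¬ p ≡ r × ¬ q ≡ r)
      point-three-lines : ∀ (p : Fin n) → ∃[ L ] ∃[ M ] ∃[ N ]
        (p on L × p on M × p on N × ¬ L ≡ M × ¬ L ≡ N × ¬ M ≡ N)
      two-points-one-line : ∀ (p q : Fin n) → ¬ p ≡ q →
        ∃[ L ] (p on L × q on L × (∀ (L' : Fin m) → p on L' → q on L' → L' ≡ L))

  -- elements of the triangle complex Δ(Γ): triples (p, L, i) with p incident with L
  record Elem : Set where
    constructor elem
    field
      pt   : Fin n
      ln   : Fin m
      type : Fin 3
      inc  : pt on ln
  open Elem public

  Inc→ : Elem → Elem → Set
  Inc→ x y = (type y ≡ next (type x))
           × (pt x on ln y)
           × (∀ (q : Fin n) → q on ln x → q on ln y → q ≡ pt x)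
           × ¬ pt x ≡ pt y

  IncΔ : Elem → Elem → Set
  IncΔ x y = x ≡ y ⊎ Inc→ x y ⊎ Inc→ y x

  record Aut : Set where
    field
      f : Elem → Elem
      g : Elem → Elem
      f∘g : ∀ x → f (g x) ≡ x
      g∘f : ∀ x → g (f x) ≡ x
      type-pres : ∀ x → type (f x) ≡ type x
      inc-pres : ∀ x y → IncΔ x y → IncΔ (f x) (f y)
      inc-refl : ∀ x y → IncΔ (f x) (f y) → IncΔ x y
  open Aut public

  record Chamber : Set where
    field
      ch : Fin 3 → Elem
      ch-type : ∀ t → type (ch t) ≡ t
      ch-inc : ∀ s t → IncΔ (ch s) (ch t)
  open Chamber public

  -- flag: set of pairwise incident elements; since incident elements of equal type are
  -- equal, a flag has at most one element per type, represented as a partial map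
  record Flag : Set where
    field
      fl : Fin 3 → Maybe Elem
      fl-type : ∀ t x → fl t ≡ just x → type x ≡ t
      fl-inc : ∀ s t x y → fl s ≡ just x → fl t ≡ just y → IncΔ x y
  open Flag public

  IsGeometry : Set
  IsGeometry = ∀ (F : Flag) → ∃[ C ] (∀ t x → fl F t ≡ just x → ch C t ≡ x)

  IsFlagTransitive : Set
  IsFlagTransitive = ∀ (C D : Chamber) → ∃[ φ ] (∀ t → f φ (ch C t) ≡ ch D t)

{-# OPTIONS --safe #-}

-- Two elements x, y of Δ(Γ) of the same type have a common successor iff their points
-- coincide or neither point lies on the other's line, and a common predecessor iff their
-- lines share a point other than both of theirs; automorphisms preserve both relations.
-- Distinct elements with a common line are exactly those with a common predecessor but no
-- common successor, so automorphisms preserve having the same line. For x, y with a common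
-- point p and different lines, pick w on the line of x at a point other than p: then x, y
-- have a common successor but no common predecessor, and w, y have no common successor.
-- If the images of x and y had different points, the point of the image of w (on the line
-- of the image of x) would lie off the line of the image of y, giving the images of w and y
-- a common successor.
module Submission where

open import Defs
open import Data.Nat using (ℕ)
open import Data.Fin using (Fin; zero; suc; _≟_)
open import Data.Bool as Bool using (Bool)
open import Data.Product using (_×_; _,_; ∃-syntax)
open import Data.Sum using (inj₁; inj₂)
open import Function using (_∘_)
open import Relation.Nullary using (¬_; yes; no; contradiction)
open import Relation.Binary.Definitions using (DecidableEquality)
open import Relation.Binary.PropositionalEquality
open import Axiom.UniquenessOfIdentityProofs using (module Decidable⇒UIP)

ThreeDistinct : {A : Set} → (A → Set) → Set
ThreeDistinct P = ∃[ x ] ∃[ y ] ∃[ z ] (P x × P y × P z × x ≢ y × x ≢ z × y ≢ z)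

avoid-two : {A : Set} {P : A → Set} → DecidableEquality A → ThreeDistinct P →
            (a b : A) → ∃[ w ] (P w × w ≢ a × w ≢ b)
avoid-two _≟_ (x , y , z , px , py , pz , x≢y , x≢z , y≢z) a b
  with x ≟ a | x ≟ b | y ≟ a | y ≟ b
... | no x≢a   | no x≢b   | _        | _        = x , px , x≢a , x≢b
... | _        | _        | no y≢a   | no y≢b   = y , py , y≢a , y≢b
... | yes refl | _        | _        | yes refl = z , pz , ≢-sym x≢z , ≢-sym y≢z
... | _        | yes refl | yes refl | _        = z , pz , ≢-sym y≢z , ≢-sym x≢z
... | yes refl | _        | yes refl | _        = contradiction refl x≢y
... | _        | yes refl | _        | yes refl = contradiction refl x≢y

prev : Fin 3 → Fin 3
prev zero = suc (suc zero)
prev (suc zero) = zero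
prev (suc (suc zero)) = suc zero

next[prev[t]]≡t : ∀ t → next (prev t) ≡ t
next[prev[t]]≡t zero = refl
next[prev[t]]≡t (suc zero) = refl
next[prev[t]]≡t (suc (suc zero)) = refl

t≢next[t] : ∀ t → t ≢ next t
t≢next[t] zero ()
t≢next[t] (suc zero) ()
t≢next[t] (suc (suc zero)) ()

t≢next[next[t]] : ∀ t → t ≢ next (next t)
t≢next[next[t]] zero ()
t≢next[next[t]] (suc zero) ()
t≢next[next[t]] (suc (suc zero)) ()

module TriangleComplex {n m : ℕ} (I : Fin n → Fin m → Bool) where

  infix 4 _∈_ _∉_ _⟶_

  _∈_ _∉_ : Fin n → Fin m → Set
  p ∈ L = _on_ I p L
  p ∉ L = ¬ p ∈ L

  _⟶_ : Elem I → Elem I → Set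
  x ⟶ y = Inc→ I x y

  record CommonSucc (x y : Elem I) : Set where
    constructor common-succ
    field
      succ : Elem I
      left : x ⟶ succ
      right : y ⟶ succ

  record CommonPred (x y : Elem I) : Set where
    constructor common-pred
    field
      pred : Elem I
      left : pred ⟶ x
      right : pred ⟶ y

  private variable
    x y z w : Elem I
    p q u : Fin n
    L M : Fin m
    i : Fin 3

  elem-irrelevant : (h h′ : p ∈ L) → elem {I = I} p L i h ≡ elem p L i h′
  elem-irrelevant {p = p} {L = L} {i = i} h h′ =
    cong (elem p L i) (Decidable⇒UIP.≡-irrelevant Bool._≟_ h h′)

  IncΔ⇒⟶ : type y ≡ next (type x) → IncΔ I x y → x ⟶ y
  IncΔ⇒⟶ {x = x} ty (inj₁ refl)            = contradiction ty (t≢next[t] (type x))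
  IncΔ⇒⟶ _          (inj₂ (inj₁ x⟶y))       = x⟶y
  IncΔ⇒⟶ {x = x} ty (inj₂ (inj₂ (tx , _))) =
    contradiction (trans tx (cong next ty)) (t≢next[next[t]] (type x))

  commonSucc-sym : CommonSucc x y → CommonSucc y x
  commonSucc-sym (common-succ z x⟶z y⟶z) = common-succ z y⟶z x⟶z

  commonSucc-collinear : CommonSucc x y → pt y ∈ ln x → pt y ≡ pt x
  commonSucc-collinear {y = y} (common-succ _ (_ , _ , meets-only-at-x , _) (_ , y∈z , _ , _)) y∈x =
    meets-only-at-x (pt y) y∈x y∈z

  commonPred-point : CommonPred x y → ∃[ u ] (u ∈ ln x × u ∈ ln y × u ≢ pt x × u ≢ pt y)
  commonPred-point (common-pred z (_ , z∈x , _ , z≢x) (_ , z∈y , _ , z≢y)) =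
    pt z , z∈x , z∈y , z≢x , z≢y

  module Automorphism (φ : Aut I) where

    image-types-agree : type x ≡ type y → type (f φ x) ≡ type (f φ y)
    image-types-agree {x = x} {y = y} tx≡ty =
      trans (type-pres φ x) (trans tx≡ty (sym (type-pres φ y)))

    ⟶-image : x ⟶ y → f φ x ⟶ f φ y
    ⟶-image {x = x} {y = y} x⟶y@(ty , _) =
      IncΔ⇒⟶ (subst₂ (λ s t → t ≡ next s) (sym (type-pres φ x)) (sym (type-pres φ y)) ty)
             (inc-pres φ x y (inj₂ (inj₁ x⟶y)))

    ⟶-preimage : f φ x ⟶ f φ y → x ⟶ y
    ⟶-preimage {x = x} {y = y} fx⟶fy@(ty , _) =
      IncΔ⇒⟶ (subst₂ (λ s t → t ≡ next s) (type-pres φ x) (type-pres φ y) ty)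
             (inc-refl φ x y (inj₂ (inj₁ fx⟶fy)))

    ⟶-preimageʳ : f φ x ⟶ z → x ⟶ g φ z
    ⟶-preimageʳ {x = x} {z = z} = ⟶-preimage ∘ subst (f φ x ⟶_) (sym (f∘g φ z))

    ⟶-preimageˡ : z ⟶ f φ x → g φ z ⟶ x
    ⟶-preimageˡ {z = z} {x = x} = ⟶-preimage ∘ subst (_⟶ f φ x) (sym (f∘g φ z))

    commonSucc-image : CommonSucc x y → CommonSucc (f φ x) (f φ y)
    commonSucc-image (common-succ z x⟶z y⟶z) = common-succ (f φ z) (⟶-image x⟶z) (⟶-image y⟶z)

    commonPred-image : CommonPred x y → CommonPred (f φ x) (f φ y)
    commonPred-image (common-pred z z⟶x z⟶y) = common-pred (f φ z) (⟶-image z⟶x) (⟶-image z⟶y)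

    commonSucc-preimage : CommonSucc (f φ x) (f φ y) → CommonSucc x y
    commonSucc-preimage (common-succ z fx⟶z fy⟶z) =
      common-succ (g φ z) (⟶-preimageʳ fx⟶z) (⟶-preimageʳ fy⟶z)

    commonPred-preimage : CommonPred (f φ x) (f φ y) → CommonPred x y
    commonPred-preimage (common-pred z z⟶fx z⟶fy) =
      common-pred (g φ z) (⟶-preimageˡ z⟶fx) (⟶-preimageˡ z⟶fy)

  module ThickLinearSpace (T : IsThickLinearSpace I) where
    open IsThickLinearSpace T

    line-unique : p ≢ q → p ∈ L → q ∈ L → p ∈ M → q ∈ M → L ≡ M
    line-unique {p = p} {q = q} {L = L} {M = M} p≢q p∈L q∈L p∈M q∈M =
      let _ , _ , _ , through-p-q = two-points-one-line p q p≢q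
      in trans (through-p-q L p∈L q∈L) (sym (through-p-q M p∈M q∈M))

    meet-unique : L ≢ M → p ∈ L → p ∈ M → q ∈ L → q ∈ M → q ≡ p
    meet-unique {p = p} {q = q} L≢M p∈L p∈M q∈L q∈M with q ≟ p
    ... | yes q≡p = q≡p
    ... | no q≢p  = contradiction (line-unique q≢p q∈L p∈L q∈M p∈M) L≢M

    point-avoiding : ∀ L a b → ∃[ u ] (u ∈ L × u ≢ a × u ≢ b)
    point-avoiding L = avoid-two _≟_ (line-three-points L)

    line-avoiding : ∀ p A B → ∃[ M ] (p ∈ M × M ≢ A × M ≢ B)
    line-avoiding p = avoid-two _≟_ (point-three-lines p)

    commonSucc-intro : type x ≡ type y → pt x ∈ M → pt y ∈ M → M ≢ ln x → M ≢ ln y →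
                       CommonSucc x y
    commonSucc-intro {x = x} {y = y} {M = M} tx≡ty x∈M y∈M M≢x M≢y
      with point-avoiding M (pt x) (pt y)
    ... | v , v∈M , v≢x , v≢y =
      common-succ (elem v M (next (type x)) v∈M)
      (refl , x∈M , (λ _ → meet-unique (≢-sym M≢x) (inc x) x∈M) , ≢-sym v≢x)
      (cong next tx≡ty , y∈M , (λ _ → meet-unique (≢-sym M≢y) (inc y) y∈M) , ≢-sym v≢y)

    commonPred-intro : type x ≡ type y → u ∈ ln x → u ∈ ln y → u ≢ pt x → u ≢ pt y →
                       CommonPred x y
    commonPred-intro {x = x} {y = y} {u = u} tx≡ty u∈x u∈y u≢x u≢y
      with line-avoiding u (ln x) (ln y)
    ... | N , u∈N , N≢x , N≢y =
      common-pred (elem u N (prev (type x)) u∈N)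
      (sym (next[prev[t]]≡t (type x)) , u∈x , (λ _ → meet-unique N≢x u∈N u∈x) , u≢x)
      (trans (sym tx≡ty) (sym (next[prev[t]]≡t (type x))) ,
       u∈y , (λ _ → meet-unique N≢y u∈N u∈y) , u≢y)

    commonSucc-of-same-point : type x ≡ type y → pt x ≡ pt y → CommonSucc x y
    commonSucc-of-same-point {x = x} {y = y} tx≡ty px≡py with line-avoiding (pt x) (ln x) (ln y)
    ... | M , x∈M , M≢x , M≢y =
      commonSucc-intro {x = x} {y = y} tx≡ty x∈M (subst (_∈ M) px≡py x∈M) M≢x M≢y

    commonSucc-of-non-collinear : type x ≡ type y → pt x ≢ pt y → pt y ∉ ln x → pt x ∉ ln y →
                                  CommonSucc x y
    commonSucc-of-non-collinear {x = x} {y = y} tx≡ty px≢py y∉x x∉y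
      with two-points-one-line (pt x) (pt y) px≢py
    ... | M , x∈M , y∈M , _ =
      commonSucc-intro {x = x} {y = y} tx≡ty x∈M y∈M
        (y∉x ∘ λ M≡x → subst (pt y ∈_) M≡x y∈M)
        (x∉y ∘ λ M≡y → subst (pt x ∈_) M≡y x∈M)

    commonPred-of-same-line : type x ≡ type y → ln x ≡ ln y → CommonPred x y
    commonPred-of-same-line {x = x} {y = y} tx≡ty lx≡ly with point-avoiding (ln x) (pt x) (pt y)
    ... | u , u∈x , u≢x , u≢y =
      commonPred-intro {x = x} {y = y} tx≡ty u∈x (subst (u ∈_) lx≡ly u∈x) u≢x u≢y

    same-line : type x ≡ type y → ¬ CommonSucc x y → CommonPred x y → ln x ≡ ln y
    same-line {x = x} {y = y} tx≡ty ¬cs cp with ln x ≟ ln y | pt x ≟ pt y | commonPred-point cp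
    ... | yes lx≡ly | _         | _ = lx≡ly
    ... | no _      | yes px≡py | _ = contradiction (commonSucc-of-same-point tx≡ty px≡py) ¬cs
    ... | no lx≢ly  | no px≢py  | u , u∈x , u∈y , u≢x , u≢y =
      contradiction (commonSucc-of-non-collinear tx≡ty px≢py y∉x x∉y) ¬cs
      where
      y∉x : pt y ∉ ln x
      y∉x y∈x = u≢y (sym (meet-unique lx≢ly u∈x u∈y y∈x (inc y)))
      x∉y : pt x ∉ ln y
      x∉y x∈y = u≢x (sym (meet-unique lx≢ly u∈x u∈y (inc x) x∈y))

    same-point : type x ≡ type y → type x ≡ type w →
                 CommonSucc x y → ¬ CommonPred x y →
                 ¬ CommonSucc x w → CommonPred x w → ¬ CommonSucc w y →
                 pt x ≡ pt y
    same-point {x = x} {y = y} {w = w} tx≡ty tx≡tw cs ¬cp ¬cs-xw cp-xw ¬cs-wy with pt x ≟ pt y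
    ... | yes px≡py = px≡py
    ... | no px≢py  =
      contradiction (commonSucc-of-non-collinear (trans (sym tx≡tw) tx≡ty) w≢y y∉w w∉y) ¬cs-wy
      where
      lx≡lw : ln x ≡ ln w
      lx≡lw = same-line tx≡tw ¬cs-xw cp-xw
      y∉x : pt y ∉ ln x
      y∉x y∈x = px≢py (sym (commonSucc-collinear cs y∈x))
      x∉y : pt x ∉ ln y
      x∉y x∈y = px≢py (commonSucc-collinear (commonSucc-sym cs) x∈y)
      w∈x : pt w ∈ ln x
      w∈x = subst (pt w ∈_) (sym lx≡lw) (inc w)
      y∉w : pt y ∉ ln w
      y∉w = y∉x ∘ subst (pt y ∈_) (sym lx≡lw)
      w≢y : pt w ≢ pt y
      w≢y w≡y = y∉x (subst (_∈ ln x) w≡y w∈x)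
      w∉y : pt w ∉ ln y
      w∉y w∈y = ¬cp (commonPred-intro tx≡ty w∈x w∈y w≢x w≢y)
        where
        w≢x : pt w ≢ pt x
        w≢x w≡x = x∉y (subst (_∈ ln y) w≡x w∈y)

    module _ (i : Fin 3) where

      collinear-configuration : (h : p ∈ L) (h′ : q ∈ L) → p ≢ q →
        ¬ CommonSucc (elem p L i h) (elem q L i h′) × CommonPred (elem p L i h) (elem q L i h′)
      collinear-configuration h h′ p≢q =
        (λ cs → p≢q (sym (commonSucc-collinear cs h′))) , commonPred-of-same-line refl refl

      concurrent-configuration : (h : p ∈ L) (h′ : p ∈ M) → L ≢ M →
        CommonSucc (elem p L i h) (elem p M i h′) × ¬ CommonPred (elem p L i h) (elem p M i h′)
      concurrent-configuration h h′ L≢M =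
        commonSucc-of-same-point refl refl ,
        λ cp → let _ , u∈L , u∈M , u≢p , _ = commonPred-point cp
               in L≢M (line-unique u≢p u∈L h u∈M h′)

      concurrent-witness : (h : p ∈ L) (h′ : p ∈ M) → ∃[ w ] (type w ≡ i ×
        ¬ CommonSucc (elem p L i h) w × CommonPred (elem p L i h) w × ¬ CommonSucc w (elem p M i h′))
      concurrent-witness {p = p} {L = L} h h′ with point-avoiding L p p
      ... | s , s∈L , s≢p , _ =
        let ¬cs , cp = collinear-configuration h s∈L (≢-sym s≢p)
        in elem s L i s∈L , refl , ¬cs , cp , λ cs → s≢p (sym (commonSucc-collinear cs h))

    module _ (φ : Aut I) (i : Fin 3) where
      open Automorphism φ

      image-ln-independent-of-point : ∀ L p q (h : p ∈ L) (h′ : q ∈ L) →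
        ln (f φ (elem p L i h)) ≡ ln (f φ (elem q L i h′))
      image-ln-independent-of-point L p q h h′ with p ≟ q
      ... | yes refl = cong (ln ∘ f φ) (elem-irrelevant h h′)
      ... | no p≢q  =
        let ¬cs , cp = collinear-configuration i h h′ p≢q
        in same-line (image-types-agree refl) (¬cs ∘ commonSucc-preimage) (commonPred-image cp)

      image-pt-independent-of-line : ∀ p L M (h : p ∈ L) (h′ : p ∈ M) →
        pt (f φ (elem p L i h)) ≡ pt (f φ (elem p M i h′))
      image-pt-independent-of-line p L M h h′ with L ≟ M
      ... | yes refl = cong (pt ∘ f φ) (elem-irrelevant h h′)
      ... | no L≢M  =
        let cs , ¬cp = concurrent-configuration i h h′ L≢M
            w , tw , ¬cs-xw , cp-xw , ¬cs-wy = concurrent-witness i h h′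
        in same-point (image-types-agree refl) (image-types-agree (sym tw))
                      (commonSucc-image cs) (¬cp ∘ commonPred-preimage)
                      (¬cs-xw ∘ commonSucc-preimage) (commonPred-image cp-xw)
                      (¬cs-wy ∘ commonSucc-preimage)

lemma3p6 : ∀ {n m : ℕ} (I : Fin n → Fin m → Bool) →
    IsThickLinearSpace I → IsGeometry I → IsFlagTransitive I →
    (φ : Aut I) (i : Fin 3) →
    (∀ (p : Fin n) (L L' : Fin m) (h : _on_ I p L) (h' : _on_ I p L') →
      pt (f φ (elem p L i h)) ≡ pt (f φ (elem p L' i h')))
    × (∀ (L : Fin m) (p p' : Fin n) (h : _on_ I p L) (h' : _on_ I p' L) →
      ln (f φ (elem p L i h)) ≡ ln (f φ (elem p' L i h')))
lemma3p6 I T _ _ φ i = image-pt-independent-of-line φ i , image-ln-independent-of-point φ i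
  where open TriangleComplex.ThickLinearSpace I T
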